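{- Let $a,b,c$ be commuting indeterminates and let $D$ be the derivation of $\mathbb{Q}[a,b,c]$ determined by $D(a)=a^2b$, $D(b)=b^2c$, $D(c)=bc^2$. For $1\le k\le n$ let $R(n,k)=k!\binom{2n-k-1}{k-1}(2n-2k-1)!!$. Then for all $n\ge 1$, $$D^n(a)=ab^{n}\sum_{k=1}^{n}R(n,k)a^{k}c^{n-k}.$$
   Context: $D$ is the formal derivative of the context-free grammar $\{a\rightarrow a^2b, b\rightarrow b^2c, c\rightarrow bc^2\}$, i.e. a linear map satisfying the Leibniz rule $D(uv)=D(u)v+uD(v)$. Double factorials: $(2m-1)!!=1\cdot3\cdots(2m-1)$, with $(-1)!!=1$. -}

module Defs where

open import Data.Nat using (ℕ; zero; suc; _∸_; _≡ᵇ_; _!) renaming (_+_ to _+ℕ_; _*_ to _*ℕ_)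
open import Data.Nat.Combinatorics using (_C_)
open import Data.Bool using (Bool; true; false; _∧_; if_then_else_)
open import Data.Integer using (+_)
open import Data.Rational using (ℚ; 0ℚ; 1ℚ; _+_; _*_; _/_)

-- A polynomial in ℚ[a,b,c] is represented by its coefficient function:
-- p i j k = coefficient of a^i b^j c^k.
Poly : Set
Poly = ℕ → ℕ → ℕ → ℚ

⟦_⟧ : ℕ → ℚ
⟦ n ⟧ = + n / 1

mon : ℕ → ℕ → ℕ → Poly
mon α β γ i j k = if (i ≡ᵇ α) ∧ (j ≡ᵇ β) ∧ (k ≡ᵇ γ) then 1ℚ else 0ℚ

_⊕_ : Poly → Poly → Poly
(p ⊕ q) i j k = p i j k + q i j k

_⊙_ : ℚ → Poly → Poly
(r ⊙ p) i j k = r * p i j k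

-- shift of a one-variable coefficient sequence (multiplication by x^α)
shift : ℕ → (ℕ → ℚ) → ℕ → ℚ
shift zero f i = f i
shift (suc α) f zero = 0ℚ
shift (suc α) f (suc i) = shift α f i

mulMon : ℕ → ℕ → ℕ → Poly → Poly
mulMon α β γ p i j k =
  shift α (λ i' → shift β (λ j' → shift γ (λ k' → p i' j' k') k) j) i

∂a ∂b ∂c : Poly → Poly
∂a p i j k = ⟦ suc i ⟧ * p (suc i) j k
∂b p i j k = ⟦ suc j ⟧ * p i (suc j) k
∂c p i j k = ⟦ suc k ⟧ * p i j (suc k)

D : Poly → Poly
D p = mulMon 2 1 0 (∂a p) ⊕ (mulMon 0 2 1 (∂b p) ⊕ mulMon 0 1 2 (∂c p))

D^ : ℕ → Poly → Poly
D^ zero p = p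
D^ (suc n) p = D (D^ n p)

polyA : Poly
polyA = mon 1 0 0

-- oddDF m = (2m-1)!!  (with (-1)!! = 1)
oddDF : ℕ → ℕ
oddDF zero = 1
oddDF (suc m) = suc (2 *ℕ m) *ℕ oddDF m

R : ℕ → ℕ → ℕ
R n k = (k !) *ℕ (((2 *ℕ n ∸ k) ∸ 1) C (k ∸ 1)) *ℕ oddDF (n ∸ k)

ΣP : ℕ → (ℕ → Poly) → Poly
ΣP zero f = λ _ _ _ → 0ℚ
ΣP (suc m) f = ΣP m f ⊕ f (suc m)

-- right-hand side: a b^n Σ_{k=1}^n R(n,k) a^k c^(n-k)
--   = Σ_{k=1}^n R(n,k) a^(k+1) b^n c^(n-k)
rhs : ℕ → Poly
rhs n = ΣP n (λ k → ⟦ R n k ⟧ ⊙ mon (suc k) n (n ∸ k))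

{-# OPTIONS --safe #-}
module Submission where

-- Every monomial of Dⁿ a has the shape a^(i+1) bⁿ c^(n-i), because
--   D(a^(i+1) bⁿ c^(n-i)) = (i+1) a^(i+2) b^(n+1) c^(n-i) + (2n-i) a^(i+1) b^(n+1) c^(n+1-i).
-- Hence its coefficients r(n,i) obey r(n+1,i) = i r(n,i-1) + (2n-i) r(n,i) with r(0,0) = 1.
-- Putting n = m+j+1 and i = j+1, the closed form becomes (j+1)! C(j+2m,j) (2m-1)!!, and it
-- satisfies the same recurrence by Pascal's rule and the absorption identity
-- (a+1) C(j+a+1,j) = (j+a+1) C(j+a,j).  All coefficients are natural numbers, so the
-- computation is done on ℕ-valued coefficient functions and transported to ℚ along the
-- semiring homomorphism ⟦_⟧.

open import Data.Bool using (true; false; T; _∧_; if_then_else_)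
open import Data.Bool.Properties using (T-∧; ∧-zeroʳ; if-float; if-eta)
import Data.Integer as ℤ
import Data.Integer.Properties as ℤ
open import Data.List using (_∷_; [])
open import Data.Nat
open import Data.Nat.Combinatorics using (_C_; nCn≡1; nCk≡n!/k![n-k]!; k![n∸k]!∣n!; nCk+nC[k+1]≡[n+1]C[k+1])
open import Data.Nat.Coprimality using (1-coprimeTo) renaming (sym to coprime-sym)
open import Data.Nat.DivMod using (m/n*n≡m)
open import Data.Nat.Properties
open import Data.Nat.Tactic.RingSolver using (solve)
open import Data.Product using (_×_; _,_)
open import Data.Rational as ℚ using (toℚᵘ)
open import Data.Rational.Properties using (normalize-coprime; toℚᵘ-injective; toℚᵘ-homo-+; toℚᵘ-homo-*)
import Data.Rational.Unnormalised as ℚᵘ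
import Data.Rational.Unnormalised.Properties as ℚᵘ
open import Function using (Equivalence; _∘_)
open import Relation.Binary.PropositionalEquality
open import Relation.Nullary using (yes; no)
open import Relation.Nullary.Decidable using (dec-true; dec-false)

open import Defs

toℚᵘ-⟦⟧ : ∀ n → toℚᵘ ⟦ n ⟧ ≡ ℚᵘ.mkℚᵘ (ℤ.+ n) 0
toℚᵘ-⟦⟧ n = cong toℚᵘ (normalize-coprime (coprime-sym (1-coprimeTo n)))

⟦⟧-homo-+ : ∀ m n → ⟦ m + n ⟧ ≡ ⟦ m ⟧ ℚ.+ ⟦ n ⟧
⟦⟧-homo-+ m n = toℚᵘ-injective (begin
  toℚᵘ ⟦ m + n ⟧                              ≡⟨ toℚᵘ-⟦⟧ (m + n) ⟩
  ℚᵘ.mkℚᵘ (ℤ.+ (m + n)) 0                      ≈⟨ ℚᵘ.*≡* (cong (ℤ._* ℤ.+ 1) numerators) ⟩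
  ℚᵘ.mkℚᵘ (ℤ.+ m) 0 ℚᵘ.+ ℚᵘ.mkℚᵘ (ℤ.+ n) 0     ≡⟨ cong₂ ℚᵘ._+_ (toℚᵘ-⟦⟧ m) (toℚᵘ-⟦⟧ n) ⟨
  toℚᵘ ⟦ m ⟧ ℚᵘ.+ toℚᵘ ⟦ n ⟧                    ≈⟨ toℚᵘ-homo-+ ⟦ m ⟧ ⟦ n ⟧ ⟨
  toℚᵘ (⟦ m ⟧ ℚ.+ ⟦ n ⟧)                        ∎)
  where
  open ℚᵘ.≃-Reasoning
  numerators : ℤ.+ (m + n) ≡ ℤ.+ m ℤ.* ℤ.+ 1 ℤ.+ ℤ.+ n ℤ.* ℤ.+ 1
  numerators = trans (ℤ.pos-+ m n) (sym (cong₂ ℤ._+_ (ℤ.*-identityʳ (ℤ.+ m)) (ℤ.*-identityʳ (ℤ.+ n))))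

⟦⟧-homo-* : ∀ m n → ⟦ m * n ⟧ ≡ ⟦ m ⟧ ℚ.* ⟦ n ⟧
⟦⟧-homo-* m n = toℚᵘ-injective (begin
  toℚᵘ ⟦ m * n ⟧                              ≡⟨ toℚᵘ-⟦⟧ (m * n) ⟩
  ℚᵘ.mkℚᵘ (ℤ.+ (m * n)) 0                      ≈⟨ ℚᵘ.*≡* (cong (ℤ._* ℤ.+ 1) (ℤ.pos-* m n)) ⟩
  ℚᵘ.mkℚᵘ (ℤ.+ m) 0 ℚᵘ.* ℚᵘ.mkℚᵘ (ℤ.+ n) 0     ≡⟨ cong₂ ℚᵘ._*_ (toℚᵘ-⟦⟧ m) (toℚᵘ-⟦⟧ n) ⟨
  toℚᵘ ⟦ m ⟧ ℚᵘ.* toℚᵘ ⟦ n ⟧                    ≈⟨ toℚᵘ-homo-* ⟦ m ⟧ ⟦ n ⟧ ⟨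
  toℚᵘ (⟦ m ⟧ ℚ.* ⟦ n ⟧)                        ∎)
  where open ℚᵘ.≃-Reasoning

Polyℕ : Set
Polyℕ = ℕ → ℕ → ℕ → ℕ

shiftℕ : ℕ → (ℕ → ℕ) → ℕ → ℕ
shiftℕ zero    f i       = f i
shiftℕ (suc α) f zero    = 0
shiftℕ (suc α) f (suc i) = shiftℕ α f i

mulMonℕ : ℕ → ℕ → ℕ → Polyℕ → Polyℕ
mulMonℕ α β γ p i j k =
  shiftℕ α (λ i′ → shiftℕ β (λ j′ → shiftℕ γ (λ k′ → p i′ j′ k′) k) j) i

_⊕ℕ_ : Polyℕ → Polyℕ → Polyℕ
(p ⊕ℕ q) i j k = p i j k + q i j k

∂aℕ ∂bℕ ∂cℕ : Polyℕ → Polyℕ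
∂aℕ p i j k = suc i * p (suc i) j k
∂bℕ p i j k = suc j * p i (suc j) k
∂cℕ p i j k = suc k * p i j (suc k)

Dℕ : Polyℕ → Polyℕ
Dℕ p = mulMonℕ 2 1 0 (∂aℕ p) ⊕ℕ (mulMonℕ 0 2 1 (∂bℕ p) ⊕ℕ mulMonℕ 0 1 2 (∂cℕ p))

monℕ : ℕ → ℕ → ℕ → Polyℕ
monℕ α β γ i j k = if (i ≡ᵇ α) ∧ (j ≡ᵇ β) ∧ (k ≡ᵇ γ) then 1 else 0

Σ₁ : ℕ → (ℕ → ℕ) → ℕ
Σ₁ zero    f = 0
Σ₁ (suc m) f = Σ₁ m f + f (suc m)

rhsℕ : ℕ → Polyℕ
rhsℕ n i j k = Σ₁ n (λ t → R n t * monℕ (suc t) n (n ∸ t) i j k)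

infix 4 _≗⟦_⟧

_≗⟦_⟧ : Poly → Polyℕ → Set
p ≗⟦ q ⟧ = ∀ i j k → p i j k ≡ ⟦ q i j k ⟧

shift-lift : ∀ α {f g} → (∀ i → f i ≡ ⟦ g i ⟧) → ∀ i → shift α f i ≡ ⟦ shiftℕ α g i ⟧
shift-lift zero    f≡g i       = f≡g i
shift-lift (suc α) f≡g zero    = refl
shift-lift (suc α) f≡g (suc i) = shift-lift α f≡g i

mulMon-lift : ∀ α β γ {p q} → p ≗⟦ q ⟧ → mulMon α β γ p ≗⟦ mulMonℕ α β γ q ⟧
mulMon-lift α β γ p≗q i j k =
  shift-lift α (λ i′ → shift-lift β (λ j′ → shift-lift γ (λ k′ → p≗q i′ j′ k′) k) j) i

⊕-lift : ∀ {p p′ q q′} → p ≗⟦ q ⟧ → p′ ≗⟦ q′ ⟧ → p ⊕ p′ ≗⟦ q ⊕ℕ q′ ⟧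
⊕-lift {q = q} {q′} p≗q p′≗q′ i j k =
  trans (cong₂ ℚ._+_ (p≗q i j k) (p′≗q′ i j k)) (sym (⟦⟧-homo-+ (q i j k) (q′ i j k)))

scale-lift : ∀ c {x} y → x ≡ ⟦ y ⟧ → ⟦ c ⟧ ℚ.* x ≡ ⟦ c * y ⟧
scale-lift c y refl = sym (⟦⟧-homo-* c y)

D-lift : ∀ {p q} → p ≗⟦ q ⟧ → D p ≗⟦ Dℕ q ⟧
D-lift {p} {q} p≗q =
  ⊕-lift {q = mulMonℕ 2 1 0 (∂aℕ q)} (mulMon-lift 2 1 0 ∂a-lift)
    (⊕-lift {q = mulMonℕ 0 2 1 (∂bℕ q)} (mulMon-lift 0 2 1 ∂b-lift) (mulMon-lift 0 1 2 ∂c-lift))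
  where
  ∂a-lift : ∂a p ≗⟦ ∂aℕ q ⟧
  ∂a-lift i j k = scale-lift (suc i) (q (suc i) j k) (p≗q (suc i) j k)
  ∂b-lift : ∂b p ≗⟦ ∂bℕ q ⟧
  ∂b-lift i j k = scale-lift (suc j) (q i (suc j) k) (p≗q i (suc j) k)
  ∂c-lift : ∂c p ≗⟦ ∂cℕ q ⟧
  ∂c-lift i j k = scale-lift (suc k) (q i j (suc k)) (p≗q i j (suc k))

mon-lift : ∀ α β γ → mon α β γ ≗⟦ monℕ α β γ ⟧
mon-lift α β γ i j k = sym (if-float ⟦_⟧ ((i ≡ᵇ α) ∧ (j ≡ᵇ β) ∧ (k ≡ᵇ γ)))

rhs-lift : ∀ n → rhs n ≗⟦ rhsℕ n ⟧
rhs-lift n i j k = ΣP-lift n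
  where
  term-lift : ∀ t → ⟦ R n t ⟧ ℚ.* mon (suc t) n (n ∸ t) i j k ≡ ⟦ R n t * monℕ (suc t) n (n ∸ t) i j k ⟧
  term-lift t = scale-lift (R n t) (monℕ (suc t) n (n ∸ t) i j k) (mon-lift (suc t) n (n ∸ t) i j k)
  ΣP-lift : ∀ m → ΣP m (λ t → ⟦ R n t ⟧ ⊙ mon (suc t) n (n ∸ t)) i j k
                ≡ ⟦ Σ₁ m (λ t → R n t * monℕ (suc t) n (n ∸ t) i j k) ⟧
  ΣP-lift zero    = refl
  ΣP-lift (suc m) = trans (cong₂ ℚ._+_ (ΣP-lift m) (term-lift (suc m))) (sym (⟦⟧-homo-+ (Σ₁ m _) _))

Dℕ-b⁰ : ∀ p i k → Dℕ p i 0 k ≡ 0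
Dℕ-b⁰ p zero          k = refl
Dℕ-b⁰ p (suc zero)    k = refl
Dℕ-b⁰ p (suc (suc i)) k = refl

-- The contributions of a²b ∂ₐp and of b²c ∂_b p + bc² ∂_c p to the coefficient of a^i b^(j+1) c^k in D p.
a-part bc-part : Polyℕ → Polyℕ
a-part p (suc (suc i)) j k = suc i * p (suc i) j k
a-part p _             j k = 0
bc-part p i j zero    = 0
bc-part p i j (suc k) = (j + k) * p i j k

Dℕ-bˢ : ∀ p i j k → Dℕ p i (suc j) k ≡ a-part p i j k + bc-part p i j k
Dℕ-bˢ p i j k = cong₂ _+_ (a-term i) (bc-term j k)
  where
  a-term : ∀ i → mulMonℕ 2 1 0 (∂aℕ p) i (suc j) k ≡ a-part p i j k
  a-term zero          = refl
  a-term (suc zero)    = refl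
  a-term (suc (suc i)) = refl
  bc-term : ∀ j k → mulMonℕ 0 2 1 (∂bℕ p) i (suc j) k + mulMonℕ 0 1 2 (∂cℕ p) i (suc j) k ≡ bc-part p i j k
  bc-term zero    zero          = refl
  bc-term zero    (suc zero)    = refl
  bc-term zero    (suc (suc k)) = refl
  bc-term (suc j) zero          = refl
  bc-term (suc j) (suc zero)    = sym (*-distribʳ-+ (p i (suc j) 0) (suc j) 0)
  bc-term (suc j) (suc (suc k)) = sym (*-distribʳ-+ (p i (suc j) (suc k)) (suc j) (suc k))

*-if : ∀ b x y → x * (if b then y else 0) ≡ (if b then x * y else 0)
*-if true  x y = refl
*-if false x y = *-zeroʳ x

if-+ : ∀ b x y → (if b then x else 0) + (if b then y else 0) ≡ (if b then x + y else 0)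
if-+ true  x y = refl
if-+ false x y = refl

if-then-cong : ∀ b {x y : ℕ} → (T b → x ≡ y) → (if b then x else 0) ≡ (if b then y else 0)
if-then-cong true  x≡y = x≡y _
if-then-cong false x≡y = refl

≡ᵇ-refl : ∀ n → (n ≡ᵇ n) ≡ true
≡ᵇ-refl n = dec-true (n ≟ n) refl

≢⇒≡ᵇ≡false : ∀ {m n} → m ≢ n → (m ≡ᵇ n) ≡ false
≢⇒≡ᵇ≡false {m} {n} = dec-false (m ≟ n)

T-≡ᵇ∧≡ᵇ : ∀ a b c d → T ((a ≡ᵇ b) ∧ (c ≡ᵇ d)) → a ≡ b × c ≡ d
T-≡ᵇ∧≡ᵇ a b c d t = let (a≡b , c≡d) = Equivalence.to T-∧ t in ≡ᵇ⇒≡ a b a≡b , ≡ᵇ⇒≡ c d c≡d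

≡ᵇ-∸ : ∀ {i n} k → i ≤ n → (k ≡ᵇ n ∸ i) ≡ (i + k ≡ᵇ n)
≡ᵇ-∸ k z≤n       = refl
≡ᵇ-∸ k (s≤s i≤n) = ≡ᵇ-∸ k i≤n

n+n∸[1+i]≡n+k : ∀ {n} i k → suc (i + k) ≡ n → n + n ∸ suc i ≡ n + k
n+n∸[1+i]≡n+k i k refl = begin
  suc (i + k) + suc (i + k) ∸ suc i ≡⟨ cong (_∸ suc i) regroup ⟩
  suc i + (suc (i + k) + k) ∸ suc i ≡⟨ m+n∸m≡n (suc i) (suc (i + k) + k) ⟩
  suc (i + k) + k                   ∎
  where
  open ≡-Reasoning
  regroup : suc (i + k) + suc (i + k) ≡ suc i + (suc (i + k) + k)
  regroup = solve (i ∷ k ∷ [])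

-- coeff n i is the coefficient of a^(i+1) bⁿ c^(n-i) in Dⁿ a.
coeff : ℕ → ℕ → ℕ
coeff zero    zero    = 1
coeff zero    (suc i) = 0
coeff (suc n) zero    = (n + n) * coeff n zero
coeff (suc n) (suc i) = suc i * coeff n i + (n + n ∸ suc i) * coeff n (suc i)

coeff-vanish : ∀ {n i} → n < i → coeff n i ≡ 0
coeff-vanish {zero}  {suc i} _         = refl
coeff-vanish {suc n} {suc i} (s≤s n<i) =
  trans (cong₂ (λ x y → suc i * x + (n + n ∸ suc i) * y) (coeff-vanish n<i) (coeff-vanish (m<n⇒m<1+n n<i)))
        (cong₂ _+_ (*-zeroʳ (suc i)) (*-zeroʳ (n + n ∸ suc i)))

coeff-suc-zero : ∀ n → coeff (suc n) 0 ≡ 0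
coeff-suc-zero zero    = refl
coeff-suc-zero (suc n) = trans (cong ((suc n + suc n) *_) (coeff-suc-zero n)) (*-zeroʳ (suc n + suc n))

coeff-diagonal : ∀ n → coeff (suc n) (suc n) ≡ suc n * coeff n n
coeff-diagonal n =
  trans (cong (λ x → suc n * coeff n n + (n + n ∸ suc n) * x) (coeff-vanish {n} ≤-refl))
        (trans (cong (suc n * coeff n n +_) (*-zeroʳ (n + n ∸ suc n))) (+-identityʳ (suc n * coeff n n)))

ansatz : ℕ → Polyℕ
ansatz n zero    j k = 0
ansatz n (suc i) j k = if (j ≡ᵇ n) ∧ (i + k ≡ᵇ n) then coeff n i else 0

ansatz-zero : polyA ≗⟦ ansatz 0 ⟧
ansatz-zero zero          j       k       = refl
ansatz-zero (suc zero)    zero    zero    = refl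
ansatz-zero (suc zero)    zero    (suc k) = refl
ansatz-zero (suc zero)    (suc j) k       = refl
ansatz-zero (suc (suc i)) zero    k       = refl
ansatz-zero (suc (suc i)) (suc j) k       = refl

ansatz-vanish : ∀ {n i} j k → coeff n i ≡ 0 → ansatz n (suc i) j k ≡ 0
ansatz-vanish {n} {i} j k coeff≡0 = trans (if-then-cong b (λ _ → coeff≡0)) (if-eta b)
  where b = (j ≡ᵇ n) ∧ (i + k ≡ᵇ n)

Dℕ-ansatz-aˢbˢ : ∀ n i j k → a-part (ansatz n) (suc i) j k + bc-part (ansatz n) (suc i) j k
                           ≡ ansatz (suc n) (suc i) (suc j) k
Dℕ-ansatz-aˢbˢ n zero    j zero    = sym (cong (λ b → if b then coeff (suc n) 0 else 0) (∧-zeroʳ (j ≡ᵇ n)))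
Dℕ-ansatz-aˢbˢ n zero    j (suc k) = begin
  (j + k) * (if b then coeff n 0 else 0) ≡⟨ *-if b (j + k) (coeff n 0) ⟩
  (if b then (j + k) * coeff n 0 else 0) ≡⟨ if-then-cong b j+k≡n+n ⟩
  (if b then (n + n) * coeff n 0 else 0) ∎
  where
  open ≡-Reasoning
  b = (j ≡ᵇ n) ∧ (k ≡ᵇ n)
  j+k≡n+n : T b → (j + k) * coeff n 0 ≡ (n + n) * coeff n 0
  j+k≡n+n t = let (j≡n , k≡n) = T-≡ᵇ∧≡ᵇ j n k n t in cong (_* coeff n 0) (cong₂ _+_ j≡n k≡n)
Dℕ-ansatz-aˢbˢ n (suc i) j zero    = begin
  suc i * (if b then coeff n i else 0) + 0 ≡⟨ +-identityʳ _ ⟩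
  suc i * (if b then coeff n i else 0)     ≡⟨ *-if b (suc i) (coeff n i) ⟩
  (if b then suc i * coeff n i else 0)     ≡⟨ if-then-cong b on-diagonal ⟩
  (if b then coeff (suc n) (suc i) else 0) ∎
  where
  open ≡-Reasoning
  b = (j ≡ᵇ n) ∧ (i + 0 ≡ᵇ n)
  on-diagonal : T b → suc i * coeff n i ≡ coeff (suc n) (suc i)
  on-diagonal t = let (_ , i+0≡n) = T-≡ᵇ∧≡ᵇ j n (i + 0) n t in
    subst (λ m → suc i * coeff m i ≡ coeff (suc m) (suc i))
          (trans (sym (+-identityʳ i)) i+0≡n) (sym (coeff-diagonal i))
Dℕ-ansatz-aˢbˢ n (suc i) j (suc k) rewrite +-suc i k = begin
  suc i * (if b then coeff n i else 0) + (j + k) * (if b then coeff n (suc i) else 0)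
    ≡⟨ cong₂ _+_ (*-if b (suc i) (coeff n i)) (*-if b (j + k) (coeff n (suc i))) ⟩
  (if b then suc i * coeff n i else 0) + (if b then (j + k) * coeff n (suc i) else 0)
    ≡⟨ if-+ b _ _ ⟩
  (if b then suc i * coeff n i + (j + k) * coeff n (suc i) else 0)
    ≡⟨ if-then-cong b (cong (λ x → suc i * coeff n i + x * coeff n (suc i)) ∘ j+k≡n+n∸[1+i]) ⟩
  (if b then coeff (suc n) (suc i) else 0) ∎
  where
  open ≡-Reasoning
  b = (j ≡ᵇ n) ∧ (suc (i + k) ≡ᵇ n)
  j+k≡n+n∸[1+i] : T b → j + k ≡ n + n ∸ suc i
  j+k≡n+n∸[1+i] t = let (j≡n , 1+i+k≡n) = T-≡ᵇ∧≡ᵇ j n (suc (i + k)) n t in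
    trans (cong (_+ k) j≡n) (sym (n+n∸[1+i]≡n+k i k 1+i+k≡n))

Dℕ-ansatz : ∀ n i j k → Dℕ (ansatz n) i j k ≡ ansatz (suc n) i j k
Dℕ-ansatz n zero    zero    k = Dℕ-b⁰ (ansatz n) 0 k
Dℕ-ansatz n (suc i) zero    k = Dℕ-b⁰ (ansatz n) (suc i) k
Dℕ-ansatz n zero    (suc j) k = trans (Dℕ-bˢ (ansatz n) 0 j k) (bc-part-a⁰ k)
  where
  bc-part-a⁰ : ∀ k → bc-part (ansatz n) 0 j k ≡ 0
  bc-part-a⁰ zero    = refl
  bc-part-a⁰ (suc k) = *-zeroʳ (j + k)
Dℕ-ansatz n (suc i) (suc j) k = trans (Dℕ-bˢ (ansatz n) (suc i) j k) (Dℕ-ansatz-aˢbˢ n i j k)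

Dⁿa≗⟦ansatz⟧ : ∀ n → D^ n polyA ≗⟦ ansatz n ⟧
Dⁿa≗⟦ansatz⟧ zero          = ansatz-zero
Dⁿa≗⟦ansatz⟧ (suc n) i j k =
  trans (D-lift {q = ansatz n} (Dⁿa≗⟦ansatz⟧ n) i j k) (cong ⟦_⟧ (Dℕ-ansatz n i j k))

C-pascal : ∀ j a → (suc j + suc a) C suc j ≡ (j + suc a) C j + (suc j + a) C suc j
C-pascal j a = trans (sym (nCk+nC[k+1]≡[n+1]C[k+1] (j + suc a) j))
                     (cong (λ n → (j + suc a) C j + n C suc j) (+-suc j a))

C-factorial : ∀ j a → ((j + a) C j) * (j ! * a !) ≡ (j + a) !
C-factorial j a = begin
  ((j + a) C j) * (j ! * a !)                                ≡⟨ cong (λ x → ((j + a) C j) * (j ! * x !)) (m+n∸m≡n j a) ⟨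
  ((j + a) C j) * (j ! * (j + a ∸ j) !)                      ≡⟨ cong (_* (j ! * (j + a ∸ j) !)) (nCk≡n!/k![n-k]! (m≤m+n j a)) ⟩
  (j + a) ! / (j ! * (j + a ∸ j) !) * (j ! * (j + a ∸ j) !)  ≡⟨ m/n*n≡m (k![n∸k]!∣n! (m≤m+n j a)) ⟩
  (j + a) !                                                  ∎
  where
  open ≡-Reasoning
  instance _ = j !* (j + a ∸ j) !≢0

C-absorb : ∀ j a → suc a * ((j + suc a) C j) ≡ suc (j + a) * ((j + a) C j)
C-absorb j a = *-cancelʳ-≡ _ _ (j ! * a !) {{j !* a !≢0}} (begin
  suc a * ((j + suc a) C j) * (j ! * a !)      ≡⟨ regroup (suc a) ((j + suc a) C j) (j !) (a !) ⟩
  ((j + suc a) C j) * (j ! * suc a !)          ≡⟨ C-factorial j (suc a) ⟩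
  (j + suc a) !                                ≡⟨ cong _! (+-suc j a) ⟩
  suc (j + a) * (j + a) !                      ≡⟨ cong (suc (j + a) *_) (C-factorial j a) ⟨
  suc (j + a) * (((j + a) C j) * (j ! * a !))  ≡⟨ *-assoc (suc (j + a)) ((j + a) C j) (j ! * a !) ⟨
  suc (j + a) * ((j + a) C j) * (j ! * a !)    ∎)
  where
  open ≡-Reasoning
  regroup : ∀ s c x y → s * c * (x * y) ≡ c * (x * (s * y))
  regroup s c x y = solve (s ∷ c ∷ x ∷ y ∷ [])

-- closedForm m j = R (m+j+1) (j+1), reparametrised to avoid truncated subtraction.
closedForm : ℕ → ℕ → ℕ
closedForm m j = suc j ! * ((j + 2 * m) C j) * oddDF m

R≡closedForm : ∀ m j → R (suc (m + j)) (suc j) ≡ closedForm m j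
R≡closedForm m j = cong₂ (λ x y → suc j ! * (x C j) * oddDF y) binomial-top (m+n∸n≡m m j)
  where
  regroup : 2 * suc (m + j) ≡ suc j + suc (j + 2 * m)
  regroup = solve (m ∷ j ∷ [])
  binomial-top : 2 * suc (m + j) ∸ suc j ∸ 1 ≡ j + 2 * m
  binomial-top = cong (_∸ 1) (trans (cong (_∸ suc j) regroup) (m+n∸m≡n (suc j) (suc (j + 2 * m))))

closedForm-zeroˡ : ∀ j → closedForm 0 j ≡ suc j !
closedForm-zeroˡ j = begin
  suc j ! * ((j + 0) C j) * 1 ≡⟨ *-identityʳ _ ⟩
  suc j ! * ((j + 0) C j)     ≡⟨ cong (λ x → suc j ! * (x C j)) (+-identityʳ j) ⟩
  suc j ! * (j C j)           ≡⟨ cong (suc j ! *_) (nCn≡1 j) ⟩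
  suc j ! * 1                 ≡⟨ *-identityʳ _ ⟩
  suc j !                     ∎
  where open ≡-Reasoning

closedForm-zeroʳ : ∀ m → closedForm m 0 ≡ oddDF m
closedForm-zeroʳ m = +-identityʳ (oddDF m)

closedForm-rec : ∀ m j → closedForm (suc m) (suc j)
                       ≡ suc (suc j) * closedForm (suc m) j + (suc (suc j) + 2 * m) * closedForm m (suc j)
closedForm-rec m j = begin
  t * F * ((suc j + 2 * suc m) C suc j) * (s * o)
    ≡⟨ cong (λ x → t * F * ((suc j + x) C suc j) * (s * o)) 2[1+m]≡2+2m ⟩
  t * F * ((suc j + suc s) C suc j) * (s * o)
    ≡⟨ cong (λ x → t * F * x * (s * o)) (C-pascal j s) ⟩
  t * F * (A + B) * (s * o)
    ≡⟨ regroup₁ t F A B s o ⟩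
  t * (F * A * (s * o)) + t * F * o * (s * B)
    ≡⟨ cong (λ x → t * (F * A * (s * o)) + t * F * o * x) (C-absorb (suc j) (2 * m)) ⟩
  t * (F * A * (s * o)) + t * F * o * ((t + 2 * m) * B′)
    ≡⟨ regroup₂ t F A B′ (s * o) o (t + 2 * m) ⟩
  t * (F * A * (s * o)) + (t + 2 * m) * (t * F * B′ * o)
    ≡⟨ cong (λ x → t * (F * ((j + x) C j) * (s * o)) + (t + 2 * m) * closedForm m (suc j)) 2[1+m]≡2+2m ⟨
  t * closedForm (suc m) j + (t + 2 * m) * closedForm m (suc j) ∎
  where
  open ≡-Reasoning
  t = suc (suc j)
  F = suc j !
  s = suc (2 * m)
  o = oddDF m
  A = (j + suc s) C j
  B = (suc j + s) C suc j
  B′ = (suc j + 2 * m) C suc j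
  2[1+m]≡2+2m : 2 * suc m ≡ suc s
  2[1+m]≡2+2m = *-suc 2 m
  regroup₁ : ∀ t F A B s o → t * F * (A + B) * (s * o) ≡ t * (F * A * (s * o)) + t * F * o * (s * B)
  regroup₁ t F A B s o = solve (t ∷ F ∷ A ∷ B ∷ s ∷ o ∷ [])
  regroup₂ : ∀ t F A B′ x o c → t * (F * A * x) + t * F * o * (c * B′) ≡ t * (F * A * x) + c * (t * F * B′ * o)
  regroup₂ t F A B′ x o c = solve (t ∷ F ∷ A ∷ B′ ∷ x ∷ o ∷ c ∷ [])

coeff≡closedForm : ∀ m j → coeff (suc (m + j)) (suc j) ≡ closedForm m j
coeff≡closedForm zero    zero    = refl
coeff≡closedForm zero    (suc j) = begin
  coeff (suc (suc j)) (suc (suc j)) ≡⟨ coeff-diagonal (suc j) ⟩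
  suc (suc j) * coeff (suc j) (suc j) ≡⟨ cong (suc (suc j) *_) (trans (coeff≡closedForm 0 j) (closedForm-zeroˡ j)) ⟩
  suc (suc j) !                     ≡⟨ closedForm-zeroˡ (suc j) ⟨
  closedForm 0 (suc j)              ∎
  where open ≡-Reasoning
coeff≡closedForm (suc m) zero    = begin
  1 * coeff (suc (m + 0)) 0 + (suc (m + 0) + suc (m + 0) ∸ 1) * coeff (suc (m + 0)) 1
    ≡⟨ cong₂ (λ x y → 1 * x + y) (coeff-suc-zero (m + 0)) (cong₂ _*_ width (coeff≡closedForm m 0)) ⟩
  suc (2 * m) * closedForm m 0
    ≡⟨ cong (suc (2 * m) *_) (closedForm-zeroʳ m) ⟩
  oddDF (suc m)
    ≡⟨ closedForm-zeroʳ (suc m) ⟨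
  closedForm (suc m) 0 ∎
  where
  open ≡-Reasoning
  regroup : m + 0 + suc (m + 0) ≡ suc (2 * m)
  regroup = solve (m ∷ [])
  width : suc (m + 0) + suc (m + 0) ∸ 1 ≡ suc (2 * m)
  width = regroup
coeff≡closedForm (suc m) (suc j) = begin
  suc t * coeff n t + (n + n ∸ suc t) * coeff n (suc t)
    ≡⟨ cong₂ (λ x y → suc t * x + y)
             (trans (cong (λ x → coeff (suc x) t) (+-suc m j)) (coeff≡closedForm (suc m) j))
             (cong₂ _*_ width (coeff≡closedForm m t)) ⟩
  suc t * closedForm (suc m) j + (suc t + 2 * m) * closedForm m t
    ≡⟨ closedForm-rec m j ⟨
  closedForm (suc m) t ∎
  where
  open ≡-Reasoning
  t = suc j
  n = suc (m + t)
  regroup : suc (m + suc j) + m ≡ suc (suc j) + 2 * m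
  regroup = solve (m ∷ j ∷ [])
  width : n + n ∸ suc t ≡ suc t + 2 * m
  width = trans (n+n∸[1+i]≡n+k t m (cong suc (+-comm t m))) regroup

R≡coeff : ∀ {n i} → 1 ≤ i → i ≤ n → R n i ≡ coeff n i
R≡coeff {suc n} {suc i} _ (s≤s i≤n) =
  subst (λ n → R (suc n) (suc i) ≡ coeff (suc n) (suc i)) (m∸n+n≡m i≤n)
        (trans (R≡closedForm (n ∸ i) i) (sym (coeff≡closedForm (n ∸ i) i)))

Σ₁-vanish : ∀ m {f} → (∀ t → 1 ≤ t → t ≤ m → f t ≡ 0) → Σ₁ m f ≡ 0
Σ₁-vanish zero    f≡0 = refl
Σ₁-vanish (suc m) f≡0 =
  cong₂ _+_ (Σ₁-vanish m (λ t 1≤t t≤m → f≡0 t 1≤t (m≤n⇒m≤1+n t≤m))) (f≡0 (suc m) (s≤s z≤n) ≤-refl)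

Σ₁-single : ∀ m {f i} → 1 ≤ i → i ≤ m → (∀ t → t ≢ i → f t ≡ 0) → Σ₁ m f ≡ f i
Σ₁-single zero    (s≤s _) ()
Σ₁-single (suc m) {f} {i} 1≤i i≤1+m off with i ≟ suc m
... | yes refl = cong (_+ f (suc m)) (Σ₁-vanish m (λ t _ t≤m → off t (<⇒≢ (s≤s t≤m))))
... | no i≢1+m = trans (cong₂ _+_ (Σ₁-single m 1≤i (≤-pred (≤∧≢⇒< i≤1+m i≢1+m)) off) (off (suc m) (≢-sym i≢1+m)))
                       (+-identityʳ (f i))

rhs-term-off : ∀ n t {i} j k → t ≢ i → R n t * monℕ (suc t) n (n ∸ t) (suc i) j k ≡ 0
rhs-term-off n t j k t≢i rewrite ≢⇒≡ᵇ≡false (≢-sym t≢i) = *-zeroʳ (R n t)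

rhsℕ≡ansatz : ∀ {n} → 1 ≤ n → ∀ i j k → rhsℕ n i j k ≡ ansatz n i j k
rhsℕ≡ansatz {n}     _ zero          j k = Σ₁-vanish n (λ t _ _ → *-zeroʳ (R n t))
rhsℕ≡ansatz {suc n} _ (suc zero)    j k = trans
  (Σ₁-vanish (suc n) (λ t 1≤t _ → rhs-term-off (suc n) t {0} j k (>⇒≢ 1≤t)))
  (sym (ansatz-vanish {i = 0} j k (coeff-suc-zero n)))
rhsℕ≡ansatz {n}     _ (suc (suc i)) j k with suc i ≤? n
... | no 1+i≰n = trans
  (Σ₁-vanish n (λ t _ t≤n → rhs-term-off n t {suc i} j k (λ { refl → 1+i≰n t≤n })))
  (sym (ansatz-vanish j k (coeff-vanish (≰⇒> 1+i≰n))))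
... | yes 1+i≤n = begin
  rhsℕ n (suc (suc i)) j k
    ≡⟨ Σ₁-single n (s≤s z≤n) 1+i≤n (λ t → rhs-term-off n t {suc i} j k) ⟩
  R n (suc i) * (if (i ≡ᵇ i) ∧ b then 1 else 0)
    ≡⟨ cong (λ c → R n (suc i) * (if c ∧ b then 1 else 0)) (≡ᵇ-refl i) ⟩
  R n (suc i) * (if b then 1 else 0)
    ≡⟨ *-if b (R n (suc i)) 1 ⟩
  (if b then R n (suc i) * 1 else 0)
    ≡⟨ cong₂ (λ c x → if (j ≡ᵇ n) ∧ c then x else 0)
             (≡ᵇ-∸ k 1+i≤n) (trans (*-identityʳ _) (R≡coeff (s≤s z≤n) 1+i≤n)) ⟩
  ansatz n (suc (suc i)) j k ∎
  where
  open ≡-Reasoning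
  b = (j ≡ᵇ n) ∧ (k ≡ᵇ n ∸ suc i)

theorem3 : ∀ (n : ℕ) → n ≥ 1 → ∀ (i j k : ℕ) → D^ n polyA i j k ≡ rhs n i j k
theorem3 n n≥1 i j k = begin
  D^ n polyA i j k     ≡⟨ Dⁿa≗⟦ansatz⟧ n i j k ⟩
  ⟦ ansatz n i j k ⟧   ≡⟨ cong ⟦_⟧ (rhsℕ≡ansatz n≥1 i j k) ⟨
  ⟦ rhsℕ n i j k ⟧     ≡⟨ rhs-lift n i j k ⟨
  rhs n i j k          ∎
  where open ≡-Reasoning
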